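{- Let $r\ge1$ and let $\mathfrak{c}^+=\{\sum_{i=1}^{r+1}a_ie^i\in E_r: a_i>0,\ i=1,\dots,r\}$. Then for every $f\in S_{A_r}$, $$\langle\langle\mathfrak{c}^+,f\rangle\rangle=\operatorname{Ires}_{x=0}f:=\operatorname{Res}_{x_1=0}\operatorname{Res}_{x_2=0}\cdots\operatorname{Res}_{x_r=0}f(x_1,\dots,x_r).$$
   Context: $e^1,\dots,e^{r+1}$ is the standard basis of $\mathbb{R}^{r+1}$, $E_r=\{\sum a_ie^i:\sum a_i=0\}$, $A_r=\{e^i-e^j:i\ne j\}$, $A_r^+=\{e^i-e^j:i<j\}$. Elements of $E_r$ are regarded as linear forms in $x_1,\dots,x_r$ via $e^i\mapsto x_i$ ($i\le r$), $e^{r+1}\mapsto0$. For a basis $\sigma\subset A_r$ of $E_r$, $f_\sigma=1/\prod_{\alpha\in\sigma}\alpha$, and $S_{A_r}=\operatorname{span}\{f_\sigma\}$. $\operatorname{Res}_{x_k=0}f$ is the coefficient of $x_k^{ -1}$ in the Laurent expansion of $f$ in $x_k$ at $0$, other variables being treated as generic (nonzero, pairwise distinct) constants; residues are taken successively starting with $x_r$. $\mathfrak{c}^+$ is a big chamber of the cone $C(A_r^+)$ generated by $A_r^+$ (big chambers being the connected components of the complement in $C(A_r^+)$ of the union of cones generated by subsets of $A_r^+$ of cardinality $<r$). $\langle\langle\mathfrak{c}^+,\cdot\rangle\rangle$ is the unique linear form on $S_{A_r}$ such that for every basis $\sigma\subset A_r^+$ of $E_r$, $\langle\langle\mathfrak{c}^+,f_\sigma\rangle\rangle=1$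 if $\mathfrak{c}^+$ is contained in the closed cone $C(\sigma)$ generated by $\sigma$, and $0$ if $\mathfrak{c}^+\cap C(\sigma)=\emptyset$.
   Formalization: The space $S_{A_r}$ is taken as the span of the $f_\sigma$ over ℚ, and the cones $C(\sigma)$ and the chamber $\mathfrak{c}^+$ consist of points of ℚ^(r+1) rather than $\mathbb{R}^{r+1}$. -}

module Defs where

open import Data.Nat as ℕ using (ℕ; zero; suc; _∸_)
open import Data.Integer as ℤ using (ℤ; +_; -[1+_])
open import Data.Rational as ℚ using (ℚ; 0ℚ; 1ℚ; _+_; _*_; _-_; -_; _≤_; _<_; 1/_; ≢-nonZero)
import Data.Rational.Properties as ℚP
open import Data.Fin as Fin using (Fin; toℕ)
import Data.Fin.Properties as FinP
open import Data.List as List using (List; []; _∷_; _++_; map; concatMap; foldr; allFin; upTo)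
open import Data.Maybe using (Maybe; just; nothing; maybe)
open import Data.Product using (Σ; ∃; _×_; _,_; proj₁; proj₂)
open import Data.Empty using (⊥)
open import Relation.Nullary using (¬_; yes; no)
open import Relation.Binary.PropositionalEquality using (_≡_; _≢_)

∑ : ∀ {n} → (Fin n → ℚ) → ℚ
∑ {zero}  f = 0ℚ
∑ {suc n} f = f Fin.zero + ∑ (λ i → f (Fin.suc i))

∏ : ∀ {n} → (Fin n → ℚ) → ℚ
∏ {zero}  f = 1ℚ
∏ {suc n} f = f Fin.zero * ∏ (λ i → f (Fin.suc i))

sumℚ : List ℚ → ℚ
sumℚ = foldr _+_ 0ℚ

-- total inverse (1/q for q ≠ 0); only used at points where q ≠ 0
inv : ℚ → ℚ
inv q with q ℚP.≟ 0ℚ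
... | yes _ = 0ℚ
... | no q≢0 = 1/_ q {{≢-nonZero q≢0}}

-- vectors of ℚ^{r+1}; coordinate p : Fin (suc r) is the coefficient of e^{p+1}
Vect : ℕ → Set
Vect r = Fin (suc r) → ℚ

_≐_ : ∀ {r} → Vect r → Vect r → Set
u ≐ v = ∀ p → u p ≡ v p

InE : ∀ {r} → Vect r → Set
InE v = ∑ v ≡ 0ℚ

Root : ℕ → Set
Root r = Σ (Fin (suc r) × Fin (suc r)) (λ ij → proj₁ ij ≢ proj₂ ij)

Positive : ∀ {r} → Root r → Set
Positive ((i , j) , _) = i Fin.< j

δ : ∀ {n} → Fin n → Fin n → ℚ
δ i p with p Fin.≟ i
... | yes _ = 1ℚ
... | no _  = 0ℚ

vec : ∀ {r} → Root r → Vect r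
vec ((i , j) , _) p = δ i p - δ j p

comb : ∀ {r} → (Fin r → Root r) → (Fin r → ℚ) → Vect r
comb σ t p = ∑ (λ k → t k * vec (σ k) p)

IsBasis : ∀ {r} → (Fin r → Root r) → Set
IsBasis {r} σ =
  (∀ (t : Fin r → ℚ) → comb σ t ≐ (λ _ → 0ℚ) → ∀ k → t k ≡ 0ℚ)
  × (∀ (v : Vect r) → InE v → ∃ λ (t : Fin r → ℚ) → comb σ t ≐ v)

Basis : ℕ → Set
Basis r = Σ (Fin r → Root r) IsBasis

PositiveBasis : ∀ {r} → Basis r → Set
PositiveBasis (σ , _) = ∀ k → Positive (σ k)

InCone : ∀ {r} → Basis r → Vect r → Set
InCone (σ , _) v = ∃ λ t → (∀ k → 0ℚ ≤ t k) × (comb σ t ≐ v)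

InCplus : ∀ {r} → Vect r → Set
InCplus {r} v = InE v × (∀ (p : Fin (suc r)) → toℕ p ℕ.< r → 0ℚ < v p)

CplusSubCone : ∀ {r} → Basis r → Set
CplusSubCone σ = ∀ v → InCplus v → InCone σ v

CplusDisjCone : ∀ {r} → Basis r → Set
CplusDisjCone σ = ∀ v → InCplus v → InCone σ v → ⊥

-- Roots as linear forms in x_1..x_r : e^i ↦ x_i (i ≤ r), e^{r+1} ↦ 0

toVar : ∀ {r} → Fin (suc r) → Maybe (Fin r)
toVar {zero}  Fin.zero    = nothing
toVar {suc r} Fin.zero    = just Fin.zero
toVar {suc r} (Fin.suc p) = Data.Maybe.map Fin.suc (toVar p)
  where import Data.Maybe

Point : ℕ → Set
Point r = Fin r → ℚ

ext : ∀ {r} → Point r → Fin (suc r) → ℚ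
ext x p = maybe x 0ℚ (toVar p)

evalRoot : ∀ {r} → Point r → Root r → ℚ
evalRoot x ((i , j) , _) = ext x i - ext x j

evalF : ∀ {r} → Basis r → Point r → ℚ
evalF (σ , _) x = ∏ (λ k → inv (evalRoot x (σ k)))

Generic : ∀ {r} → Point r → Set
Generic {r} x = (∀ i → x i ≢ 0ℚ) × (∀ (i j : Fin r) → i ≢ j → x i ≢ x j)

-- S_{A_r}: elements given as finite linear combinations Σ c_σ f_σ

SElt : ℕ → Set
SElt r = List (ℚ × Basis r)

evalS : ∀ {r} → SElt r → Point r → ℚ
evalS f x = sumℚ (map (λ cσ → proj₁ cσ * evalF (proj₂ cσ) x) f)

_≈S_ : ∀ {r} → SElt r → SElt r → Set
f ≈S g = ∀ x → Generic x → evalS f x ≡ evalS g x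

-- a linear form on S_{A_r}: given by its values ℓ on the generators f_σ,
-- extended linearly, and well defined on the span
extend : ∀ {r} → (Basis r → ℚ) → SElt r → ℚ
extend ℓ f = sumℚ (map (λ cσ → proj₁ cσ * ℓ (proj₂ cσ)) f)

IsLinearFormOnS : ∀ {r} → (Basis r → ℚ) → Set
IsLinearFormOnS {r} ℓ = ∀ (f g : SElt r) → f ≈S g → extend ℓ f ≡ extend ℓ g

IsCplusForm : ∀ {r} → (Basis r → ℚ) → Set
IsCplusForm {r} ℓ = IsLinearFormOnS ℓ ×
  (∀ (σ : Basis r) → PositiveBasis σ →
     (CplusSubCone σ → ℓ σ ≡ 1ℚ) × (CplusDisjCone σ → ℓ σ ≡ 0ℚ))

-- (c , a , fs) represents c · ∏_i x_i^{a i} · ∏_{(i,j) ∈ fs} 1/(x_i - x_j)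
Term : ℕ → Set
Term r = ℚ × (Fin r → ℤ) × List (Fin r × Fin r)

Func : ℕ → Set
Func r = List (Term r)

oneT : ∀ {r} → Term r
oneT = 1ℚ , (λ _ → + 0) , []

mulT : ∀ {r} → Term r → Term r → Term r
mulT (c , a , fs) (d , b , gs) = c * d , (λ i → a i ℤ.+ b i) , fs ++ gs

mulF : ∀ {r} → Func r → Func r → Func r
mulF f g = concatMap (λ s → map (mulT s) g) f

δℤ : ∀ {r} → Fin r → ℤ → Fin r → ℤ
δℤ i e p with p Fin.≟ i
... | yes _ = e
... | no _  = + 0

-- Laurent series in x_k:  Σ_{n ≥ 0} co n · x_k^{v + n},
-- coefficients being functions of the other variables
record Series (r : ℕ) : Set where
  constructor ser
  field
    v  : ℤ
    co : ℕ → Func r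
open Series public

mulS : ∀ {r} → Series r → Series r → Series r
mulS s t = ser (v s ℤ.+ v t)
  (λ n → concatMap (λ i → mulF (co s i) (co t (n ∸ i))) (upTo (suc n)))

constS : ∀ {r} → Func r → Series r
constS f = ser (+ 0) (λ { zero → f ; (suc _) → [] })

powS : ∀ {r} → ℤ → Series r
powS e = ser e (λ { zero → oneT ∷ [] ; (suc _) → [] })

-- Laurent expansion in x_k of 1/(x_i - x_j) (other variables generic constants):
--   1/(x_i - x_k) = Σ_n x_i^{-1-n} x_k^n ,  1/(x_k - x_j) = - Σ_n x_j^{-1-n} x_k^n
factorS : ∀ {r} → Fin r → Fin r × Fin r → Series r
factorS k (i , j) with j Fin.≟ k | i Fin.≟ k
... | yes _ | _     = ser (+ 0) (λ n → (1ℚ , δℤ i (-[1+ n ]) , []) ∷ [])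
... | no _  | yes _ = ser (+ 0) (λ n → (- 1ℚ , δℤ j (-[1+ n ]) , []) ∷ [])
... | no _  | no _  = constS ((1ℚ , (λ _ → + 0) , (i , j) ∷ []) ∷ [])

expandT : ∀ {r} → Fin r → Term r → Series r
expandT k (c , a , fs) =
  foldr (λ ij s → mulS (factorS k ij) s)
        (mulS (powS (a k)) (constS ((c , rest , []) ∷ [])))
        fs
  where
  rest : Fin _ → ℤ
  rest p with p Fin.≟ k
  ... | yes _ = + 0
  ... | no _  = a p

-- coefficient of x_k^{-1}
resS : ∀ {r} → Series r → Func r
resS s with ℤ.-[1+ 0 ] ℤ.- v s
... | + n      = co s n
... | -[1+ _ ] = []

Res : ∀ {r} → Fin r → Func r → Func r
Res k f = concatMap (λ t → resS (expandT k t)) f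

-- Ires_{x=0} = Res_{x_1=0} Res_{x_2=0} ⋯ Res_{x_r=0}  (x_r first)
IresF : ∀ {r} → Func r → Func r
IresF {r} f = foldr Res f (allFin r)

-- after all r residues the result is a constant: the sum of its coefficients
constValue : ∀ {r} → Func r → ℚ
constValue f = sumℚ (map proj₁ f)

rootT : ∀ {r} → Root r → Term r
rootT ((i , j) , _) with toVar i | toVar j
... | just i' | just j' = 1ℚ , (λ _ → + 0) , (i' , j') ∷ []
... | just i' | nothing = 1ℚ , δℤ i' (-[1+ 0 ]) , []
... | nothing | just j' = - 1ℚ , δℤ j' (-[1+ 0 ]) , []
... | nothing | nothing = oneT

fσT : ∀ {r} → Basis r → Term r
fσT {r} (σ , _) = foldr (λ k t → mulT (rootT (σ k)) t) oneT (allFin r)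

toFunc : ∀ {r} → SElt r → Func r
toFunc f = map (λ cσ → mulT (proj₁ cσ , (λ _ → + 0) , []) (fσT (proj₂ cσ))) f

Ires : ∀ {r} → SElt r → ℚ
Ires f = constValue (IresF (toFunc f))

-- Both sides are linear in f, so it suffices to take f = c · f_σ. Reversing a root changes f_σ
-- by a sign, so ⟨⟨c⁺, f_σ⟩⟩ is determined by the positive basis σ⁺ obtained by orienting every
-- root of σ. Give each positive root e^i − e^j (i < j) its lower index i ≤ r.
--
-- If the lower indices of σ⁺ are exactly 1, …, r, the coordinates of a point of c⁺ in σ⁺ are
-- solved triangularly and are positive, so c⁺ ⊆ C(σ⁺). On the residue side, when the residue in
-- x_k is taken the factors 1/(x_k − x_q), q > k, have already become x_k^{-1}, and altogether x_k
-- has a simple pole; so every residue takes the leading coefficient and Ires f_σ is the product of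
-- the orientation signs of σ, as is ⟨⟨c⁺, f_σ⟩⟩.
--
-- Otherwise some index w is no lower index. Then the w-th coordinate is ≤ 0 on C(σ⁺), so
-- c⁺ ∩ C(σ⁺) = ∅, while f_σ has no pole in x_w and acquires none from the residues in x_{w+1}, …,
-- x_r, so the residue in x_w vanishes.

module Submission where

open import Defs
open import Data.Nat using (ℕ; _≤_)
open import Data.Rational using (ℚ)
open import Relation.Binary.PropositionalEquality using (_≡_)

open import Algebra.Bundles using (CommutativeMonoid)
open import Data.Empty using (⊥-elim)
open import Data.Fin as Fin using (Fin; toℕ)
import Data.Fin.Properties as FinP
open import Data.Integer as ℤ using (ℤ; -[1+_])
import Data.Integer.Properties as ℤP
open import Data.List using (List; []; _∷_; _++_; foldr; concatMap; allFin; upTo; tabulate; length; filter)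
import Data.List.Properties as ListP
open import Data.List.Relation.Unary.All as All using (All; []; _∷_)
open import Data.List.Relation.Unary.All.Properties using (++⁺; concat⁺; map⁺)
open import Data.Maybe using (just; nothing)
open import Data.Nat using (zero; suc)
import Data.Nat as ℕ
open import Data.Nat.Induction using (<-rec)
import Data.Nat.Properties as ℕP
open import Data.Product using (∃; _×_; _,_; proj₁; proj₂)
open import Data.Rational as ℚ using (0ℚ; 1ℚ; _+_; _*_; _-_; -_)
import Data.Rational.Properties as ℚP
open import Data.Rational.Solver using (module +-*-Solver)
open import Data.Sum using (_⊎_; inj₁; inj₂)
open import Function using (_∘_; case_of_)
open import Relation.Binary.PropositionalEquality
  using (refl; sym; trans; cong; cong₂; subst; subst₂; _≢_; module ≡-Reasoning)
open import Relation.Nullary using (¬_; yes; no; Dec)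
open import Relation.Nullary.Decidable using (_×-dec_; _⊎-dec_)

open import Algebra.Properties.CommutativeSemigroup ℕP.+-commutativeSemigroup using (interchange)
open import Algebra.Properties.CommutativeSemigroup
  (CommutativeMonoid.commutativeSemigroup ℚP.*-1-commutativeMonoid)
  using () renaming (interchange to *-interchange)

residues : ∀ {r} → List (Fin r) → Func r → Func r
residues ks f = foldr Res f ks

residues-++ : ∀ {r} ks (f g : Func r) → residues ks (f ++ g) ≡ residues ks f ++ residues ks g
residues-++ []       f g = refl
residues-++ (k ∷ ks) f g =
  trans (cong (Res k) (residues-++ ks f g)) (ListP.concatMap-++ _ (residues ks f) _)

residues-[] : ∀ {r} (ks : List (Fin r)) → residues ks [] ≡ []
residues-[] []       = refl
residues-[] (k ∷ ks) = cong (Res k) (residues-[] ks)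

constValue-++ : ∀ {r} (f g : Func r) → constValue (f ++ g) ≡ constValue f + constValue g
constValue-++ []      g = sym (ℚP.+-identityˡ _)
constValue-++ (t ∷ f) g =
  trans (cong (proj₁ t +_) (constValue-++ f g)) (sym (ℚP.+-assoc (proj₁ t) _ _))

coefficient : ∀ {r} → Term r → ℚ
coefficient = proj₁

exponents : ∀ {r} → Term r → Fin r → ℤ
exponents t = proj₁ (proj₂ t)

factors : ∀ {r} → Term r → List (Fin r × Fin r)
factors t = proj₂ (proj₂ t)

δℤ-same : ∀ {r} {i p : Fin r} e → p ≡ i → δℤ i e p ≡ e
δℤ-same {i = i} {p} e p≡i with p Fin.≟ i
... | yes _   = refl
... | no p≢i  = ⊥-elim (p≢i p≡i)

δℤ-other : ∀ {r} {i p : Fin r} e → p ≢ i → δℤ i e p ≡ ℤ.+ 0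
δℤ-other {i = i} {p} e p≢i with p Fin.≟ i
... | yes p≡i = ⊥-elim (p≢i p≡i)
... | no _    = refl

leadingFactor : ∀ {r} → Fin r → Fin r × Fin r → Term r
leadingFactor k (i , j) with j Fin.≟ k | i Fin.≟ k
... | yes _ | _     = 1ℚ , δℤ i -[1+ 0 ] , []
... | no _  | yes _ = - 1ℚ , δℤ j -[1+ 0 ] , []
... | no _  | no _  = 1ℚ , (λ _ → ℤ.+ 0) , (i , j) ∷ []

leading-factorS : ∀ {r} (k : Fin r) ij → co (factorS k ij) 0 ≡ leadingFactor k ij ∷ []
leading-factorS k (i , j) with j Fin.≟ k | i Fin.≟ k
... | yes _ | _     = refl
... | no _  | yes _ = refl
... | no _  | no _  = refl

valuation-factorS : ∀ {r} (k : Fin r) ij → v (factorS k ij) ≡ ℤ.+ 0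
valuation-factorS k (i , j) with j Fin.≟ k | i Fin.≟ k
... | yes _ | _     = refl
... | no _  | yes _ = refl
... | no _  | no _  = refl

expandFactors : ∀ {r} → Fin r → List (Fin r × Fin r) → Series r → Series r
expandFactors k gs s = foldr (λ ij s′ → mulS (factorS k ij) s′) s gs

leadingTerm : ∀ {r} → Fin r → List (Fin r × Fin r) → Term r → Term r
leadingTerm k gs b = foldr (λ ij u → mulT (leadingFactor k ij) u) b gs

leading-expandFactors : ∀ {r} (k : Fin r) gs (s : Series r) b → co s 0 ≡ b ∷ [] →
  co (expandFactors k gs s) 0 ≡ leadingTerm k gs b ∷ []
leading-expandFactors k []       s b eq = eq
leading-expandFactors k (g ∷ gs) s b eq
  rewrite leading-factorS k g | leading-expandFactors k gs s b eq = refl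

valuation-expandFactors : ∀ {r} (k : Fin r) gs (s : Series r) → v (expandFactors k gs s) ≡ v s
valuation-expandFactors k []       s = refl
valuation-expandFactors k (g ∷ gs) s
  rewrite valuation-factorS k g | valuation-expandFactors k gs s = ℤP.+-identityˡ _

-- The monomial part free of x_k is local to expandT; it is recovered as a witness.
expandT-shape : ∀ {r} (k : Fin r) c a fs → ∃ λ rest →
  expandT k (c , a , fs) ≡ expandFactors k fs (mulS (powS (a k)) (constS ((c , rest , []) ∷ [])))
expandT-shape k c a fs = _ , refl

expandT-shape-rest : ∀ {r} (k : Fin r) c a fs p → p ≢ k → proj₁ (expandT-shape k c a fs) p ≡ a p
expandT-shape-rest k c a fs p p≢k with p Fin.≟ k
... | yes p≡k = ⊥-elim (p≢k p≡k)
... | no _    = refl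

resS-valuation-−1 : ∀ {r} (s : Series r) → v s ≡ -[1+ 0 ] → resS s ≡ co s 0
resS-valuation-−1 (ser w c) refl = refl

resS-valuation-0 : ∀ {r} (s : Series r) → v s ≡ ℤ.+ 0 → resS s ≡ []
resS-valuation-0 (ser w c) refl = refl

valuation-expandT : ∀ {r} (k : Fin r) c a fs → v (expandT k (c , a , fs)) ≡ a k
valuation-expandT k c a fs = begin
  v (expandT k (c , a , fs))     ≡⟨ cong v (proj₂ (expandT-shape k c a fs)) ⟩
  v (expandFactors k fs base)    ≡⟨ valuation-expandFactors k fs base ⟩
  a k ℤ.+ ℤ.+ 0                  ≡⟨ ℤP.+-identityʳ (a k) ⟩
  a k                            ∎
  where
  open ≡-Reasoning
  base : Series _
  base = mulS (powS (a k)) (constS ((c , proj₁ (expandT-shape k c a fs) , []) ∷ []))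

residueTerm : ∀ {r} → Fin r → ℚ → (Fin r → ℤ) → List (Fin r × Fin r) → Term r
residueTerm k c a fs = leadingTerm k fs (mulT oneT (c , proj₁ (expandT-shape k c a fs) , []))

Res-simplePole : ∀ {r} (k : Fin r) c a fs → a k ≡ -[1+ 0 ] →
  Res k ((c , a , fs) ∷ []) ≡ residueTerm k c a fs ∷ []
Res-simplePole k c a fs ak≡-1 = begin
  resS (expandT k (c , a , fs)) ++ []  ≡⟨ ListP.++-identityʳ _ ⟩
  resS (expandT k (c , a , fs))        ≡⟨ resS-valuation-−1 _ (trans (valuation-expandT k c a fs) ak≡-1) ⟩
  co (expandT k (c , a , fs)) 0        ≡⟨ cong (λ s → co s 0) (proj₂ (expandT-shape k c a fs)) ⟩
  co (expandFactors k fs _) 0          ≡⟨ leading-expandFactors k fs _ _ refl ⟩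
  residueTerm k c a fs ∷ []            ∎
  where open ≡-Reasoning

-- Pole orders and the sign read off by the iterated residue

Upward : ∀ {r} → Fin r → Fin r × Fin r → Set
Upward p (i , j) = (i ≡ p × toℕ p ℕ.< toℕ j) ⊎ (j ≡ p × toℕ p ℕ.< toℕ i)

upward? : ∀ {r} (p : Fin r) ij → Dec (Upward p ij)
upward? p (i , j) =
  ((i Fin.≟ p) ×-dec (toℕ p ℕ.<? toℕ j)) ⊎-dec ((j Fin.≟ p) ×-dec (toℕ p ℕ.<? toℕ i))

upwardCount : ∀ {r} → Fin r → List (Fin r × Fin r) → ℕ
upwardCount p fs = length (filter (upward? p) fs)

upwardCount-++ : ∀ {r} (p : Fin r) fs gs →
  upwardCount p (fs ++ gs) ≡ upwardCount p fs ℕ.+ upwardCount p gs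
upwardCount-++ p fs gs =
  trans (cong length (ListP.filter-++ (upward? p) fs gs)) (ListP.length-++ (filter (upward? p) fs))

upwardCount-∷ : ∀ {r} (p : Fin r) f fs → Upward p f → upwardCount p (f ∷ fs) ≡ suc (upwardCount p fs)
upwardCount-∷ p f fs up = cong length (ListP.filter-accept (upward? p) up)

upwardCount-∷-¬ : ∀ {r} (p : Fin r) f fs → ¬ Upward p f → upwardCount p (f ∷ fs) ≡ upwardCount p fs
upwardCount-∷-¬ p f fs ¬up = cong length (ListP.filter-reject (upward? p) ¬up)

-- x_p has pole order m in t, counting each factor 1/(x_p − x_q) with q > p as one:
-- the residue in x_q turns that factor into x_p^{-1}.
record PoleOrder {r} (t : Term r) (p : Fin r) (m : ℕ) : Set where
  constructor poleOrder
  field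
    order     : ℕ
    exponent≡ : exponents t p ≡ ℤ.- (ℤ.+ order)
    count≡    : order ℕ.+ upwardCount p (factors t) ≡ m

Below : ∀ {r} → ℕ → Fin r × Fin r → Set
Below j (i , i′) = toℕ i ℕ.< j × toℕ i′ ℕ.< j × i ≢ i′

SimplePoles : ∀ {r} → ℕ → Term r → Set
SimplePoles {r} j t = All (Below j) (factors t) × (∀ (p : Fin r) → toℕ p ℕ.< j → PoleOrder t p 1)

orientation : ℕ → ℕ → ℚ
orientation m n with m ℕ.<? n
... | yes _ = 1ℚ
... | no _  = - 1ℚ

orientation-< : ∀ {m n} → m ℕ.< n → orientation m n ≡ 1ℚ
orientation-< {m} {n} m<n with m ℕ.<? n
... | yes _   = refl
... | no m≮n  = ⊥-elim (m≮n m<n)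

orientation-> : ∀ {m n} → n ℕ.< m → orientation m n ≡ - 1ℚ
orientation-> {m} {n} n<m with m ℕ.<? n
... | yes m<n = ⊥-elim (ℕP.<-asym m<n n<m)
... | no _    = refl

factorsSign : ∀ {r} → List (Fin r × Fin r) → ℚ
factorsSign []             = 1ℚ
factorsSign ((i , j) ∷ fs) = orientation (toℕ i) (toℕ j) * factorsSign fs

signedCoef : ∀ {r} → Term r → ℚ
signedCoef t = coefficient t * factorsSign (factors t)

<-suc-≢⇒< : ∀ {n} {i k : Fin n} → toℕ i ℕ.< suc (toℕ k) → i ≢ k → toℕ i ℕ.< toℕ k
<-suc-≢⇒< i<k+1 i≢k = ℕP.≤∧≢⇒< (ℕP.≤-pred i<k+1) (λ e → i≢k (FinP.toℕ-injective e))

signedCoef-leadingFactor : ∀ {r} (k : Fin r) {i j} u → Below (suc (toℕ k)) (i , j) →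
  signedCoef (mulT (leadingFactor k (i , j)) u) ≡ orientation (toℕ i) (toℕ j) * signedCoef u
signedCoef-leadingFactor k {i} {j} u (i<k+1 , j<k+1 , i≢j) with j Fin.≟ k | i Fin.≟ k
... | yes refl | _
  rewrite orientation-< (<-suc-≢⇒< i<k+1 i≢j) = ℚP.*-assoc 1ℚ (coefficient u) (factorsSign (factors u))
... | no j≢k | yes refl
  rewrite orientation-> (<-suc-≢⇒< j<k+1 j≢k) = ℚP.*-assoc (- 1ℚ) (coefficient u) (factorsSign (factors u))
... | no _ | no _ = pull (orientation (toℕ i) (toℕ j)) (coefficient u) (factorsSign (factors u))
  where
  open +-*-Solver
  pull : ∀ o C P → (1ℚ * C) * (o * P) ≡ o * (C * P)
  pull = solve 3 (λ o C P → (con 1ℚ :* C) :* (o :* P) := o :* (C :* P)) refl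

signedCoef-leadingTerm : ∀ {r} (k : Fin r) gs b → All (Below (suc (toℕ k))) gs →
  signedCoef (leadingTerm k gs b) ≡ factorsSign gs * signedCoef b
signedCoef-leadingTerm k []             b []             = sym (ℚP.*-identityˡ _)
signedCoef-leadingTerm k ((i , j) ∷ gs) b (ij<k+1 ∷ below) = begin
  signedCoef (mulT (leadingFactor k (i , j)) (leadingTerm k gs b))
    ≡⟨ signedCoef-leadingFactor k (leadingTerm k gs b) ij<k+1 ⟩
  orientation (toℕ i) (toℕ j) * signedCoef (leadingTerm k gs b)
    ≡⟨ cong (orientation (toℕ i) (toℕ j) *_) (signedCoef-leadingTerm k gs b below) ⟩
  orientation (toℕ i) (toℕ j) * (factorsSign gs * signedCoef b)
    ≡⟨ ℚP.*-assoc (orientation (toℕ i) (toℕ j)) (factorsSign gs) (signedCoef b) ⟨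
  orientation (toℕ i) (toℕ j) * factorsSign gs * signedCoef b
    ∎
  where open ≡-Reasoning

-ℤ+-distrib : ∀ m n → ℤ.- (ℤ.+ m) ℤ.+ ℤ.- (ℤ.+ n) ≡ ℤ.- (ℤ.+ (m ℕ.+ n))
-ℤ+-distrib m n = sym (trans (cong ℤ.-_ (ℤP.pos-+ m n)) (ℤP.neg-distrib-+ (ℤ.+ m) (ℤ.+ n)))

PoleOrder-mulT : ∀ {r} {x y : Term r} {p m n} → PoleOrder x p m → PoleOrder y p n → PoleOrder (mulT x y) p (m ℕ.+ n)
PoleOrder-mulT {x = x} {y} {p} (poleOrder a ex cx) (poleOrder b ey cy) =
  poleOrder (a ℕ.+ b) (trans (cong₂ ℤ._+_ ex ey) (-ℤ+-distrib a b)) (begin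
    (a ℕ.+ b) ℕ.+ upwardCount p (factors x ++ factors y)
      ≡⟨ cong ((a ℕ.+ b) ℕ.+_) (upwardCount-++ p (factors x) (factors y)) ⟩
    (a ℕ.+ b) ℕ.+ (upwardCount p (factors x) ℕ.+ upwardCount p (factors y))
      ≡⟨ interchange a b _ _ ⟩
    (a ℕ.+ upwardCount p (factors x)) ℕ.+ (b ℕ.+ upwardCount p (factors y))
      ≡⟨ cong₂ ℕ._+_ cx cy ⟩
    _ ∎)
  where open ≡-Reasoning

PoleOrder-pole : ∀ {r} c {q p : Fin r} → p ≡ q → PoleOrder (c , δℤ q -[1+ 0 ] , []) p 1
PoleOrder-pole c p≡q = poleOrder 1 (δℤ-same _ p≡q) refl

PoleOrder-regular : ∀ {r} c {q p : Fin r} → p ≢ q → PoleOrder (c , δℤ q -[1+ 0 ] , []) p 0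
PoleOrder-regular c p≢q = poleOrder 0 (δℤ-other _ p≢q) refl

PoleOrder-mulT-monomial : ∀ {r} c (q : Fin r) f gs {p u m} → (Upward p f → p ≡ q) → (p ≡ q → Upward p f) →
  PoleOrder u p (upwardCount p gs ℕ.+ m) →
  PoleOrder (mulT (c , δℤ q -[1+ 0 ] , []) u) p (upwardCount p (f ∷ gs) ℕ.+ m)
PoleOrder-mulT-monomial c q f gs {p} {u} {m} up⇒≡ ≡⇒up po = byCase (p Fin.≟ q)
  where
  byCase : Dec (p ≡ q) → PoleOrder (mulT (c , δℤ q -[1+ 0 ] , []) u) p (upwardCount p (f ∷ gs) ℕ.+ m)
  byCase (yes p≡q) = subst (PoleOrder _ p) (cong (ℕ._+ m) (sym (upwardCount-∷ p f gs (≡⇒up p≡q))))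
                       (PoleOrder-mulT (PoleOrder-pole c p≡q) po)
  byCase (no p≢q)  = subst (PoleOrder _ p) (cong (ℕ._+ m) (sym (upwardCount-∷-¬ p f gs (p≢q ∘ up⇒≡))))
                       (PoleOrder-mulT (PoleOrder-regular c p≢q) po)

PoleOrder-leadingTerm : ∀ {r} (k : Fin r) gs b {p m} → All (Below (suc (toℕ k))) gs →
  toℕ p ℕ.< toℕ k → PoleOrder b p m → PoleOrder (leadingTerm k gs b) p (upwardCount p gs ℕ.+ m)
PoleOrder-leadingTerm k []             b _           p<k po = po
PoleOrder-leadingTerm k ((i , j) ∷ gs) b {p} {m} (_ ∷ below) p<k po
  with j Fin.≟ k | i Fin.≟ k | PoleOrder-leadingTerm k gs b below p<k po
... | yes refl | _ | ih = PoleOrder-mulT-monomial 1ℚ i (i , j) gs up⇒≡ (λ p≡i → inj₁ (sym p≡i , p<k)) ih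
  where
  up⇒≡ : Upward p (i , j) → p ≡ i
  up⇒≡ (inj₁ (i≡p , _)) = sym i≡p
  up⇒≡ (inj₂ (j≡p , _)) = ⊥-elim (ℕP.<-irrefl (cong toℕ (sym j≡p)) p<k)
... | no _ | yes refl | ih = PoleOrder-mulT-monomial (- 1ℚ) j (i , j) gs up⇒≡ (λ p≡j → inj₂ (sym p≡j , p<k)) ih
  where
  up⇒≡ : Upward p (i , j) → p ≡ j
  up⇒≡ (inj₁ (i≡p , _)) = ⊥-elim (ℕP.<-irrefl (cong toℕ (sym i≡p)) p<k)
  up⇒≡ (inj₂ (j≡p , _)) = sym j≡p
... | no _ | no _ | ih = subst (PoleOrder _ p) count≡ (PoleOrder-mulT factor ih)
  where
  factor : PoleOrder (1ℚ , (λ _ → ℤ.+ 0) , (i , j) ∷ []) p (upwardCount p ((i , j) ∷ []))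
  factor = poleOrder 0 refl refl
  count≡ : upwardCount p ((i , j) ∷ []) ℕ.+ (upwardCount p gs ℕ.+ m) ≡ upwardCount p ((i , j) ∷ gs) ℕ.+ m
  count≡ = trans (sym (ℕP.+-assoc (upwardCount p ((i , j) ∷ [])) (upwardCount p gs) m))
    (cong (ℕ._+ m) (sym (upwardCount-++ p ((i , j) ∷ []) gs)))

leadingTerm-below : ∀ {r} (k : Fin r) gs b → All (Below (suc (toℕ k))) gs → All (Below (toℕ k)) (factors b) →
  All (Below (toℕ k)) (factors (leadingTerm k gs b))
leadingTerm-below k []             b []                            bb = bb
leadingTerm-below k ((i , j) ∷ gs) b ((i<k+1 , j<k+1 , i≢j) ∷ below) bb with j Fin.≟ k | i Fin.≟ k
... | yes _   | _       = leadingTerm-below k gs b below bb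
... | no _    | yes _   = leadingTerm-below k gs b below bb
... | no j≢k  | no i≢k  = (<-suc-≢⇒< i<k+1 i≢k , <-suc-≢⇒< j<k+1 j≢k , i≢j) ∷ leadingTerm-below k gs b below bb

upwardCount-top : ∀ {r} (k : Fin r) fs → All (Below (suc (toℕ k))) fs → upwardCount k fs ≡ 0
upwardCount-top k fs below = cong length (ListP.filter-none (upward? k) (All.map ¬upward below))
  where
  ¬upward : ∀ {ij} → Below (suc (toℕ k)) ij → ¬ Upward k ij
  ¬upward (_ , j<k+1 , _) (inj₁ (_ , k<j)) = ℕP.<⇒≱ k<j (ℕP.≤-pred j<k+1)
  ¬upward (i<k+1 , _ , _) (inj₂ (_ , k<i)) = ℕP.<⇒≱ k<i (ℕP.≤-pred i<k+1)

simplePole-exponent : ∀ {r} {t : Term r} {p} → PoleOrder t p 1 → upwardCount p (factors t) ≡ 0 →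
  exponents t p ≡ -[1+ 0 ]
simplePole-exponent (poleOrder n e cnt) none =
  trans e (cong (λ n → ℤ.- (ℤ.+ n)) (trans (sym (ℕP.+-identityʳ n)) (trans (cong (n ℕ.+_) (sym none)) cnt)))

Res-simplePoles : ∀ {r} (k : Fin r) (t : Term r) → SimplePoles (suc (toℕ k)) t →
  ∃ λ t′ → Res k (t ∷ []) ≡ t′ ∷ [] × SimplePoles (toℕ k) t′ × signedCoef t′ ≡ signedCoef t
Res-simplePoles {r} k (c , a , fs) (below , simple) =
  residueTerm k c a fs , Res-simplePole k c a fs ak≡-1 ,
  (leadingTerm-below k fs b below [] , simple′) , signedCoef≡
  where
  b : Term r
  b = mulT oneT (c , proj₁ (expandT-shape k c a fs) , [])
  ak≡-1 : a k ≡ -[1+ 0 ]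
  ak≡-1 = simplePole-exponent (simple k (ℕP.n<1+n _)) (upwardCount-top k fs below)
  simple′ : ∀ p → toℕ p ℕ.< toℕ k → PoleOrder (residueTerm k c a fs) p 1
  simple′ p p<k with simple p (ℕP.<-trans p<k (ℕP.n<1+n _))
  ... | poleOrder n ap≡-n cnt = subst (PoleOrder _ p) (trans (ℕP.+-comm (upwardCount p fs) n) cnt)
    (PoleOrder-leadingTerm k fs b below p<k (poleOrder n bp≡-n (ℕP.+-identityʳ n)))
    where
    bp≡-n : ℤ.+ 0 ℤ.+ proj₁ (expandT-shape k c a fs) p ≡ ℤ.- (ℤ.+ n)
    bp≡-n = trans (ℤP.+-identityˡ _)
      (trans (expandT-shape-rest k c a fs p (λ p≡k → ℕP.<-irrefl (cong toℕ p≡k) p<k)) ap≡-n)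
  signedCoef≡ : signedCoef (residueTerm k c a fs) ≡ c * factorsSign fs
  signedCoef≡ = trans (signedCoef-leadingTerm k fs b below) (simplify (factorsSign fs) c)
    where
    open +-*-Solver
    simplify : ∀ s c → s * ((1ℚ * c) * 1ℚ) ≡ c * s
    simplify = solve 2 (λ s c → s :* ((con 1ℚ :* c) :* con 1ℚ) := c :* s) refl

data Range (r : ℕ) : ℕ → List (Fin r) → Set where
  done : Range r r []
  next : ∀ {j k ks} → toℕ k ≡ j → Range r (suc j) ks → Range r j (k ∷ ks)

tabulate-range : ∀ {r} n j (g : Fin n → Fin r) → (∀ i → toℕ (g i) ≡ j ℕ.+ toℕ i) → j ℕ.+ n ≡ r →
  Range r j (tabulate g)
tabulate-range zero    j g tg j+0≡r = subst (λ j → Range _ j []) (trans (sym j+0≡r) (ℕP.+-identityʳ j)) done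
tabulate-range (suc n) j g tg j+n≡r =
  next (trans (tg Fin.zero) (ℕP.+-identityʳ j))
       (tabulate-range n (suc j) (g ∘ Fin.suc) (λ i → trans (tg (Fin.suc i)) (ℕP.+-suc j (toℕ i)))
         (trans (sym (ℕP.+-suc j n)) j+n≡r))

allFin-range : ∀ r → Range r 0 (allFin r)
allFin-range r = tabulate-range r 0 (λ i → i) (λ i → refl) refl

residues-simplePoles : ∀ {r j ks} → Range r j ks → ∀ t → SimplePoles r t →
  ∃ λ t′ → residues ks (t ∷ []) ≡ t′ ∷ [] × SimplePoles j t′ × signedCoef t′ ≡ signedCoef t
residues-simplePoles done t simple = t , refl , simple , refl
residues-simplePoles (next {k = k} refl range) t simple =
  let (t′ , res≡ , simple′ , sc≡) = residues-simplePoles range t simple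
      (t″ , res′≡ , simple″ , sc′≡) = Res-simplePoles k t′ simple′
  in t″ , trans (cong (Res k) res≡) res′≡ , simple″ , trans sc′≡ sc≡

constValue-simplePoles₀ : ∀ {r} (t : Term r) → SimplePoles 0 t → constValue (t ∷ []) ≡ signedCoef t
constValue-simplePoles₀ (c , a , [])          _                = trans (ℚP.+-identityʳ c) (sym (ℚP.*-identityʳ c))
constValue-simplePoles₀ (c , a , _ ∷ _) ((() , _) ∷ _ , _)

Ires-simplePoles : ∀ {r} (t : Term r) → SimplePoles r t → constValue (IresF (t ∷ [])) ≡ signedCoef t
Ires-simplePoles {r} t simple =
  let (t′ , res≡ , simple′ , sc≡) = residues-simplePoles (allFin-range r) t simple
  in trans (cong constValue res≡) (trans (constValue-simplePoles₀ t′ simple′) sc≡)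

-- Terms without a pole in x_w

-- t has no pole in x_w, and none can appear through the residues in the x_q with q > w.
record PoleFree {r} (w : Fin r) (t : Term r) : Set where
  constructor poleFree
  field
    exponent≡0 : exponents t w ≡ ℤ.+ 0
    noUpward   : All (¬_ ∘ Upward w) (factors t)

PoleFree-mulT : ∀ {r} {w : Fin r} {x y} → PoleFree w x → PoleFree w y → PoleFree w (mulT x y)
PoleFree-mulT (poleFree ex ux) (poleFree ey uy) = poleFree (cong₂ ℤ._+_ ex ey) (++⁺ ux uy)

upwardCount≡0 : ∀ {r} (p : Fin r) fs → upwardCount p fs ≡ 0 → All (¬_ ∘ Upward p) fs
upwardCount≡0 p []       _    = []
upwardCount≡0 p (f ∷ fs) none with upward? p f
... | yes up = case trans (sym (upwardCount-∷ p f fs up)) none of λ ()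
... | no ¬up = ¬up ∷ upwardCount≡0 p fs (trans (sym (upwardCount-∷-¬ p f fs ¬up)) none)

PoleOrder-0⇒PoleFree : ∀ {r} {t : Term r} {w} → PoleOrder t w 0 → PoleFree w t
PoleOrder-0⇒PoleFree {t = t} {w} (poleOrder zero e cnt) = poleFree e (upwardCount≡0 w (factors t) cnt)

concatMap⁺ : ∀ {A B : Set} {P : B → Set} (h : A → List B) xs → (∀ x → All P (h x)) → All P (concatMap h xs)
concatMap⁺ h xs all-h = concat⁺ (map⁺ (All.universal all-h xs))

PoleFree-mulF : ∀ {r} {w : Fin r} {f g} → All (PoleFree w) f → All (PoleFree w) g → All (PoleFree w) (mulF f g)
PoleFree-mulF pf pg = concat⁺ (map⁺ (All.map (λ px → map⁺ (All.map (PoleFree-mulT px) pg)) pf))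

SeriesPoleFree : ∀ {r} → Fin r → Series r → Set
SeriesPoleFree w s = ∀ n → All (PoleFree w) (co s n)

SeriesPoleFree-mulS : ∀ {r} {w : Fin r} s t → SeriesPoleFree w s → SeriesPoleFree w t →
  SeriesPoleFree w (mulS s t)
SeriesPoleFree-mulS s t ps pt n = concatMap⁺ _ (upTo (suc n)) (λ i → PoleFree-mulF (ps i) (pt (n ℕ.∸ i)))

SeriesPoleFree-powS : ∀ {r} {w : Fin r} e → SeriesPoleFree w (powS e)
SeriesPoleFree-powS e zero    = poleFree refl [] ∷ []
SeriesPoleFree-powS e (suc n) = []

SeriesPoleFree-constS : ∀ {r} {w : Fin r} {x} → PoleFree w x → SeriesPoleFree w (constS (x ∷ []))
SeriesPoleFree-constS px zero    = px ∷ []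
SeriesPoleFree-constS px (suc n) = []

SeriesPoleFree-factorS : ∀ {r} {w : Fin r} k ij → toℕ w ℕ.< toℕ k → ¬ Upward w ij →
  SeriesPoleFree w (factorS k ij)
SeriesPoleFree-factorS {w = w} k (i , j) w<k ¬up with j Fin.≟ k | i Fin.≟ k
... | yes refl | _ = λ n → poleFree (δℤ-other _ (λ w≡i → ¬up (inj₁ (sym w≡i , w<k)))) [] ∷ []
... | no _ | yes refl = λ n → poleFree (δℤ-other _ (λ w≡j → ¬up (inj₂ (sym w≡j , w<k)))) [] ∷ []
... | no _ | no _ = SeriesPoleFree-constS (poleFree refl (¬up ∷ []))

SeriesPoleFree-expandFactors : ∀ {r} {w : Fin r} k gs s → toℕ w ℕ.< toℕ k →
  All (¬_ ∘ Upward w) gs → SeriesPoleFree w s → SeriesPoleFree w (expandFactors k gs s)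
SeriesPoleFree-expandFactors k []       s w<k []           ps = ps
SeriesPoleFree-expandFactors k (g ∷ gs) s w<k (¬up ∷ ¬ups) ps =
  SeriesPoleFree-mulS (factorS k g) (expandFactors k gs s)
    (SeriesPoleFree-factorS k g w<k ¬up) (SeriesPoleFree-expandFactors k gs s w<k ¬ups ps)

SeriesPoleFree-expandT : ∀ {r} {w : Fin r} k t → toℕ w ℕ.< toℕ k → PoleFree w t → SeriesPoleFree w (expandT k t)
SeriesPoleFree-expandT {w = w} k (c , a , fs) w<k (poleFree aw≡0 ¬ups) =
  subst (SeriesPoleFree w) (sym (proj₂ (expandT-shape k c a fs)))
    (SeriesPoleFree-expandFactors k fs _ w<k ¬ups
      (SeriesPoleFree-mulS (powS (a k)) (constS (free ∷ []))
        (SeriesPoleFree-powS (a k)) (SeriesPoleFree-constS (poleFree freew≡0 []))))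
  where
  free : Term _
  free = c , proj₁ (expandT-shape k c a fs) , []
  freew≡0 : exponents free w ≡ ℤ.+ 0
  freew≡0 = trans (expandT-shape-rest k c a fs w (λ w≡k → ℕP.<-irrefl (cong toℕ w≡k) w<k)) aw≡0

PoleFree-resS : ∀ {r} {w : Fin r} s → SeriesPoleFree w s → All (PoleFree w) (resS s)
PoleFree-resS s ps with -[1+ 0 ] ℤ.- v s
... | ℤ.+ n    = ps n
... | -[1+ _ ] = []

PoleFree-Res : ∀ {r} {w : Fin r} k f → toℕ w ℕ.< toℕ k → All (PoleFree w) f → All (PoleFree w) (Res k f)
PoleFree-Res k []      w<k []        = []
PoleFree-Res k (t ∷ f) w<k (pt ∷ pf) =
  ++⁺ (PoleFree-resS (expandT k t) (SeriesPoleFree-expandT k t w<k pt)) (PoleFree-Res k f w<k pf)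

Res-poleFree : ∀ {r} (w : Fin r) f → All (PoleFree w) f → Res w f ≡ []
Res-poleFree w []                  []                       = refl
Res-poleFree w ((c , a , fs) ∷ f) (poleFree aw≡0 _ ∷ pf) =
  cong₂ _++_ (resS-valuation-0 _ (trans (valuation-expandT w c a fs) aw≡0)) (Res-poleFree w f pf)

residues-poleFree : ∀ {r j ks} (w : Fin r) f → Range r j ks → All (PoleFree w) f →
  (toℕ w ℕ.< j × All (PoleFree w) (residues ks f)) ⊎ residues ks f ≡ []
residues-poleFree w f done pf = inj₁ (FinP.toℕ<n w , pf)
residues-poleFree w f (next {k = k} {ks} refl range) pf = oneMore (residues-poleFree w f range pf)
  where
  oneMore : (toℕ w ℕ.< suc (toℕ k) × All (PoleFree w) (residues ks f)) ⊎ residues ks f ≡ [] →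
    (toℕ w ℕ.< toℕ k × All (PoleFree w) (residues (k ∷ ks) f)) ⊎ residues (k ∷ ks) f ≡ []
  oneMore (inj₂ vanished) = inj₂ (cong (Res k) vanished)
  oneMore (inj₁ (w<k+1 , pf′)) with ℕP.m<1+n⇒m<n∨m≡n w<k+1
  ... | inj₁ w<k = inj₁ (w<k , PoleFree-Res k _ w<k pf′)
  ... | inj₂ w≡k = inj₂ (subst (λ k → Res k (residues ks f) ≡ []) (FinP.toℕ-injective w≡k) (Res-poleFree w _ pf′))

Ires-poleFree : ∀ {r} (w : Fin r) f → All (PoleFree w) f → IresF f ≡ []
Ires-poleFree {r} w f pf with residues-poleFree w f (allFin-range r) pf
... | inj₁ (() , _)
... | inj₂ vanished = vanished

orient : ∀ {r} → Root r → Root r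
orient ((i , j) , i≢j) with toℕ i ℕ.<? toℕ j
... | yes _ = (i , j) , i≢j
... | no _  = (j , i) , i≢j ∘ sym

source target : ∀ {r} → Root r → Fin (suc r)
source α = proj₁ (proj₁ α)
target α = proj₂ (proj₁ α)

lowerIndex : ∀ {r} → Root r → ℕ
lowerIndex α = toℕ (source (orient α))

rootOrientation : ∀ {r} → Root r → ℚ
rootOrientation ((i , j) , _) = orientation (toℕ i) (toℕ j)

≢∧≮⇒> : ∀ {n} {i j : Fin n} → i ≢ j → ¬ (toℕ i ℕ.< toℕ j) → toℕ j ℕ.< toℕ i
≢∧≮⇒> i≢j i≮j = ℕP.≤∧≢⇒< (ℕP.≮⇒≥ i≮j) (λ e → i≢j (FinP.toℕ-injective (sym e)))

orient-positive : ∀ {r} (α : Root r) → toℕ (source (orient α)) ℕ.< toℕ (target (orient α))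
orient-positive ((i , j) , i≢j) with toℕ i ℕ.<? toℕ j
... | yes i<j = i<j
... | no i≮j  = ≢∧≮⇒> i≢j i≮j

lowerIndex<r : ∀ {r} (α : Root r) → lowerIndex α ℕ.< r
lowerIndex<r α = ℕP.<-≤-trans (orient-positive α) (ℕP.≤-pred (FinP.toℕ<n (target (orient α))))

lowerIndex-< : ∀ {r} {i j : Fin (suc r)} i≢j → toℕ i ℕ.< toℕ j → lowerIndex ((i , j) , i≢j) ≡ toℕ i
lowerIndex-< {i = i} {j} _ i<j with toℕ i ℕ.<? toℕ j
... | yes _   = refl
... | no i≮j  = ⊥-elim (i≮j i<j)

lowerIndex-> : ∀ {r} {i j : Fin (suc r)} i≢j → toℕ j ℕ.< toℕ i → lowerIndex ((i , j) , i≢j) ≡ toℕ j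
lowerIndex-> {i = i} {j} _ j<i with toℕ i ℕ.<? toℕ j
... | yes i<j = ⊥-elim (ℕP.<-asym i<j j<i)
... | no _    = refl

toVar-just : ∀ {r} (p : Fin (suc r)) {q} → toVar p ≡ just q → toℕ q ≡ toℕ p
toVar-just {zero}  Fin.zero    ()
toVar-just {suc r} Fin.zero    refl = refl
toVar-just {suc r} (Fin.suc p) e with toVar p in ep
toVar-just {suc r} (Fin.suc p) refl | just q = cong suc (toVar-just p ep)

toVar-nothing : ∀ {r} (p : Fin (suc r)) → toVar p ≡ nothing → toℕ p ≡ r
toVar-nothing {zero}  Fin.zero    refl = refl
toVar-nothing {suc r} Fin.zero    ()
toVar-nothing {suc r} (Fin.suc p) e with toVar p in ep
toVar-nothing {suc r} (Fin.suc p) refl | nothing = cong suc (toVar-nothing p ep)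

indicator : ∀ {A : Set} → Dec A → ℕ
indicator (yes _) = 1
indicator (no _)  = 0

indicator-yes : ∀ {A : Set} (d : Dec A) → A → indicator d ≡ 1
indicator-yes (yes _) _ = refl
indicator-yes (no ¬a) a = ⊥-elim (¬a a)

indicator-no : ∀ {A : Set} (d : Dec A) → ¬ A → indicator d ≡ 0
indicator-no (yes a) ¬a = ⊥-elim (¬a a)
indicator-no (no _)  _  = refl

upward⇔lowerIndex : ∀ {r} {i j : Fin (suc r)} i≢j {i′ j′ p : Fin r} → toℕ i′ ≡ toℕ i → toℕ j′ ≡ toℕ j →
  (Upward p (i′ , j′) → lowerIndex ((i , j) , i≢j) ≡ toℕ p) × (lowerIndex ((i , j) , i≢j) ≡ toℕ p → Upward p (i′ , j′))
upward⇔lowerIndex {i = i} {j} i≢j {i′} {j′} {p} ti tj with toℕ i ℕ.<? toℕ j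
... | yes i<j = upward⇒ , λ i≡p → inj₁ (FinP.toℕ-injective (trans ti i≡p) , subst₂ ℕ._<_ i≡p (sym tj) i<j)
  where
  upward⇒ : Upward p (i′ , j′) → toℕ i ≡ toℕ p
  upward⇒ (inj₁ (i′≡p , _))   = trans (sym ti) (cong toℕ i′≡p)
  upward⇒ (inj₂ (j′≡p , p<i′)) = ⊥-elim (ℕP.<-asym i<j (subst₂ ℕ._<_ (trans (cong toℕ (sym j′≡p)) tj) ti p<i′))
... | no i≮j = upward⇒ , λ j≡p → inj₂ (FinP.toℕ-injective (trans tj j≡p) , subst₂ ℕ._<_ j≡p (sym ti) j<i)
  where
  j<i : toℕ j ℕ.< toℕ i
  j<i = ≢∧≮⇒> i≢j i≮j
  upward⇒ : Upward p (i′ , j′) → toℕ j ≡ toℕ p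
  upward⇒ (inj₁ (i′≡p , p<j′)) = ⊥-elim (ℕP.<-asym j<i (subst₂ ℕ._<_ (trans (cong toℕ (sym i′≡p)) ti) tj p<j′))
  upward⇒ (inj₂ (j′≡p , _))   = trans (sym tj) (cong toℕ j′≡p)

toVar-just-< : ∀ {r} (i j : Fin (suc r)) {i′} → toVar i ≡ just i′ → toVar j ≡ nothing → toℕ i ℕ.< toℕ j
toVar-just-< i j {i′} ei ej = subst₂ ℕ._<_ (toVar-just i ei) (sym (toVar-nothing j ej)) (FinP.toℕ<n i′)

toVar-nothing-unique : ∀ {r} (i j : Fin (suc r)) → toVar i ≡ nothing → toVar j ≡ nothing → i ≡ j
toVar-nothing-unique i j ei ej = FinP.toℕ-injective (trans (toVar-nothing i ei) (sym (toVar-nothing j ej)))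

PoleOrder-monomialRoot : ∀ {r} c (q p : Fin r) {L} → L ≡ toℕ q →
  PoleOrder (c , δℤ q -[1+ 0 ] , []) p (indicator (L ℕ.≟ toℕ p))
PoleOrder-monomialRoot c q p {L} L≡q = byCase (p Fin.≟ q)
  where
  byCase : Dec (p ≡ q) → PoleOrder (c , δℤ q -[1+ 0 ] , []) p (indicator (L ℕ.≟ toℕ p))
  byCase (yes p≡q) = subst (PoleOrder _ p) (sym (indicator-yes (L ℕ.≟ toℕ p) (trans L≡q (cong toℕ (sym p≡q)))))
    (PoleOrder-pole c p≡q)
  byCase (no p≢q)  = subst (PoleOrder _ p)
    (sym (indicator-no (L ℕ.≟ toℕ p) (λ L≡p → p≢q (FinP.toℕ-injective (trans (sym L≡p) L≡q)))))
    (PoleOrder-regular c p≢q)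

PoleOrder-rootT : ∀ {r} (α : Root r) p → PoleOrder (rootT α) p (indicator (lowerIndex α ℕ.≟ toℕ p))
PoleOrder-rootT ((i , j) , i≢j) p with toVar i in ei | toVar j in ej
... | just i′ | just j′ = poleOrder 0 refl (count (upward? p (i′ , j′)))
  where
  equiv : (Upward p (i′ , j′) → lowerIndex ((i , j) , i≢j) ≡ toℕ p) ×
          (lowerIndex ((i , j) , i≢j) ≡ toℕ p → Upward p (i′ , j′))
  equiv = upward⇔lowerIndex i≢j (toVar-just i ei) (toVar-just j ej)
  count : Dec (Upward p (i′ , j′)) →
    upwardCount p ((i′ , j′) ∷ []) ≡ indicator (lowerIndex ((i , j) , i≢j) ℕ.≟ toℕ p)
  count (yes up) = trans (upwardCount-∷ p _ [] up) (sym (indicator-yes _ (proj₁ equiv up)))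
  count (no ¬up) = trans (upwardCount-∷-¬ p _ [] ¬up) (sym (indicator-no _ (¬up ∘ proj₂ equiv)))
... | just i′ | nothing = PoleOrder-monomialRoot 1ℚ i′ p
  (trans (lowerIndex-< i≢j (toVar-just-< i j ei ej)) (sym (toVar-just i ei)))
... | nothing | just j′ = PoleOrder-monomialRoot (- 1ℚ) j′ p
  (trans (lowerIndex-> i≢j (toVar-just-< j i ej ei)) (sym (toVar-just j ej)))
... | nothing | nothing = ⊥-elim (i≢j (toVar-nothing-unique i j ei ej))

signedCoef-rootT : ∀ {r} (α : Root r) → signedCoef (rootT α) ≡ rootOrientation α
signedCoef-rootT ((i , j) , i≢j) with toVar i in ei | toVar j in ej
... | just i′ | just j′ = trans (ℚP.*-identityˡ _)
  (trans (ℚP.*-identityʳ _) (cong₂ orientation (toVar-just i ei) (toVar-just j ej)))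
... | just i′ | nothing = sym (orientation-< (toVar-just-< i j ei ej))
... | nothing | just j′ = sym (orientation-> (toVar-just-< j i ej ei))
... | nothing | nothing = ⊥-elim (i≢j (toVar-nothing-unique i j ei ej))

rootT-below : ∀ {r} (α : Root r) → All (Below r) (factors (rootT α))
rootT-below ((i , j) , i≢j) with toVar i in ei | toVar j in ej
... | just i′ | just j′ = (FinP.toℕ<n i′ , FinP.toℕ<n j′ , i′≢j′) ∷ []
  where
  i′≢j′ : i′ ≢ j′
  i′≢j′ i′≡j′ = i≢j (FinP.toℕ-injective (trans (sym (toVar-just i ei)) (trans (cong toℕ i′≡j′) (toVar-just j ej))))
... | just i′ | nothing = []
... | nothing | just j′ = []
... | nothing | nothing = []

rootsTerm : ∀ {r n} → (Fin r → Root r) → (Fin n → Fin r) → Term r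
rootsTerm σ g = foldr (λ k t → mulT (rootT (σ k)) t) oneT (tabulate g)

factorsSign-++ : ∀ {r} (fs gs : List (Fin r × Fin r)) → factorsSign (fs ++ gs) ≡ factorsSign fs * factorsSign gs
factorsSign-++ []             gs = sym (ℚP.*-identityˡ _)
factorsSign-++ ((i , j) ∷ fs) gs =
  trans (cong (orientation (toℕ i) (toℕ j) *_) (factorsSign-++ fs gs))
        (sym (ℚP.*-assoc (orientation (toℕ i) (toℕ j)) (factorsSign fs) (factorsSign gs)))

signedCoef-mulT : ∀ {r} (x y : Term r) → signedCoef (mulT x y) ≡ signedCoef x * signedCoef y
signedCoef-mulT x y = trans (cong (coefficient x * coefficient y *_) (factorsSign-++ (factors x) (factors y)))
  (*-interchange (coefficient x) (coefficient y) (factorsSign (factors x)) (factorsSign (factors y)))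

signedCoef-rootsTerm : ∀ {r n} (σ : Fin r → Root r) (g : Fin n → Fin r) →
  signedCoef (rootsTerm σ g) ≡ ∏ (λ i → rootOrientation (σ (g i)))
signedCoef-rootsTerm {n = zero}  σ g = ℚP.*-identityˡ _
signedCoef-rootsTerm {n = suc n} σ g =
  trans (signedCoef-mulT (rootT (σ (g Fin.zero))) (rootsTerm σ (g ∘ Fin.suc)))
        (cong₂ _*_ (signedCoef-rootT (σ (g Fin.zero))) (signedCoef-rootsTerm σ (g ∘ Fin.suc)))

rootsTerm-below : ∀ {r n} (σ : Fin r → Root r) (g : Fin n → Fin r) → All (Below r) (factors (rootsTerm σ g))
rootsTerm-below {n = zero}  σ g = []
rootsTerm-below {n = suc n} σ g = ++⁺ (rootT-below (σ (g Fin.zero))) (rootsTerm-below σ (g ∘ Fin.suc))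

PoleOrder-rootsTerm-none : ∀ {r n} (σ : Fin r → Root r) (g : Fin n → Fin r) p →
  (∀ i → lowerIndex (σ (g i)) ≢ toℕ p) → PoleOrder (rootsTerm σ g) p 0
PoleOrder-rootsTerm-none {n = zero}  σ g p missed = poleOrder 0 refl refl
PoleOrder-rootsTerm-none {n = suc n} σ g p missed = PoleOrder-mulT
  (subst (PoleOrder _ p) (indicator-no _ (missed Fin.zero)) (PoleOrder-rootT (σ (g Fin.zero)) p))
  (PoleOrder-rootsTerm-none σ (g ∘ Fin.suc) p (missed ∘ Fin.suc))

PoleOrder-rootsTerm-unique : ∀ {r n} (σ : Fin r → Root r) (g : Fin n → Fin r) p i₀ →
  lowerIndex (σ (g i₀)) ≡ toℕ p → (∀ i → lowerIndex (σ (g i)) ≡ toℕ p → i ≡ i₀) →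
  PoleOrder (rootsTerm σ g) p 1
PoleOrder-rootsTerm-unique σ g p Fin.zero hit unique = PoleOrder-mulT
  (subst (PoleOrder _ p) (indicator-yes _ hit) (PoleOrder-rootT (σ (g Fin.zero)) p))
  (PoleOrder-rootsTerm-none σ (g ∘ Fin.suc) p (λ i hitᵢ → FinP.0≢1+n (sym (unique (Fin.suc i) hitᵢ))))
PoleOrder-rootsTerm-unique σ g p (Fin.suc i₀) hit unique = PoleOrder-mulT
  (subst (PoleOrder _ p) (indicator-no _ (λ hit₀ → FinP.0≢1+n (unique Fin.zero hit₀))) (PoleOrder-rootT (σ (g Fin.zero)) p))
  (PoleOrder-rootsTerm-unique σ (g ∘ Fin.suc) p i₀ hit (λ i hitᵢ → FinP.suc-injective (unique (Fin.suc i) hitᵢ)))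

basisOrientation : ∀ {r} → (Fin r → Root r) → ℚ
basisOrientation σ = ∏ (λ k → rootOrientation (σ k))

generatorTerm : ∀ {r} → ℚ → Basis r → Term r
generatorTerm c B = mulT (c , (λ _ → ℤ.+ 0) , []) (fσT B)

PoleOrder-constant : ∀ {r} c (p : Fin r) → PoleOrder (c , (λ _ → ℤ.+ 0) , []) p 0
PoleOrder-constant c p = poleOrder 0 refl refl

Ires-generator-bijective : ∀ {r} c (σ : Fin r → Root r) b →
  (∀ k k′ → lowerIndex (σ k) ≡ lowerIndex (σ k′) → k ≡ k′) → (∀ (p : Fin r) → ∃ λ k → lowerIndex (σ k) ≡ toℕ p) →
  constValue (IresF (generatorTerm c (σ , b) ∷ [])) ≡ c * basisOrientation σ
Ires-generator-bijective {r} c σ b injective surjective = begin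
  constValue (IresF (generatorTerm c (σ , b) ∷ []))  ≡⟨ Ires-simplePoles _ (rootsTerm-below σ (λ k → k) , simple) ⟩
  signedCoef (generatorTerm c (σ , b))               ≡⟨ signedCoef-mulT (c , (λ _ → ℤ.+ 0) , []) (fσT (σ , b)) ⟩
  (c * 1ℚ) * signedCoef (fσT (σ , b))                ≡⟨ cong₂ _*_ (ℚP.*-identityʳ c) (signedCoef-rootsTerm σ (λ k → k)) ⟩
  c * basisOrientation σ                             ∎
  where
  open ≡-Reasoning
  simple : ∀ (p : Fin r) → toℕ p ℕ.< r → PoleOrder (generatorTerm c (σ , b)) p 1
  simple p _ = PoleOrder-mulT (PoleOrder-constant c p)
    (PoleOrder-rootsTerm-unique σ (λ k → k) p k₀ (proj₂ (surjective p))
      (λ k hit → injective k k₀ (trans hit (sym (proj₂ (surjective p))))))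
    where
    k₀ : Fin r
    k₀ = proj₁ (surjective p)

Ires-generator-missing : ∀ {r} c (σ : Fin r → Root r) b w → (∀ k → lowerIndex (σ k) ≢ toℕ w) →
  IresF (generatorTerm c (σ , b) ∷ []) ≡ []
Ires-generator-missing c σ b w missed = Ires-poleFree w _
  (PoleOrder-0⇒PoleFree (PoleOrder-mulT (PoleOrder-constant c w) (PoleOrder-rootsTerm-none σ (λ k → k) w missed)) ∷ [])

-- Reorienting a basis

∑-cong : ∀ {n} {f g : Fin n → ℚ} → (∀ k → f k ≡ g k) → ∑ f ≡ ∑ g
∑-cong {zero}  f≗g = refl
∑-cong {suc n} f≗g = cong₂ _+_ (f≗g Fin.zero) (∑-cong (f≗g ∘ Fin.suc))

∏-cong : ∀ {n} {f g : Fin n → ℚ} → (∀ k → f k ≡ g k) → ∏ f ≡ ∏ g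
∏-cong {zero}  f≗g = refl
∏-cong {suc n} f≗g = cong₂ _*_ (f≗g Fin.zero) (∏-cong (f≗g ∘ Fin.suc))

∏-distrib-* : ∀ {n} (f g : Fin n → ℚ) → ∏ (λ k → f k * g k) ≡ ∏ f * ∏ g
∏-distrib-* {zero}  f g = refl
∏-distrib-* {suc n} f g = trans (cong (f Fin.zero * g Fin.zero *_) (∏-distrib-* (f ∘ Fin.suc) (g ∘ Fin.suc)))
  (*-interchange (f Fin.zero) (g Fin.zero) _ _)

∏-ones : ∀ {n} (f : Fin n → ℚ) → (∀ k → f k ≡ 1ℚ) → ∏ f ≡ 1ℚ
∏-ones {zero}  f f≗1 = refl
∏-ones {suc n} f f≗1 = cong₂ _*_ (f≗1 Fin.zero) (∏-ones (f ∘ Fin.suc) (f≗1 ∘ Fin.suc))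

rootOrientation² : ∀ {r} (α : Root r) → rootOrientation α * rootOrientation α ≡ 1ℚ
rootOrientation² ((i , j) , _) with toℕ i ℕ.<? toℕ j
... | yes _ = refl
... | no _  = refl

basisOrientation² : ∀ {r} (σ : Fin r → Root r) → basisOrientation σ * basisOrientation σ ≡ 1ℚ
basisOrientation² σ = trans (sym (∏-distrib-* (rootOrientation ∘ σ) (rootOrientation ∘ σ)))
  (∏-ones _ (rootOrientation² ∘ σ))

module _ where
  open +-*-Solver

  b-a≡-1*[a-b] : ∀ a b → b - a ≡ - 1ℚ * (a - b)
  b-a≡-1*[a-b] = solve 2 (λ a b → b :- a := (:- con 1ℚ) :* (a :- b)) refl

  -1*a≡-a : ∀ a → - 1ℚ * a ≡ - a
  -1*a≡-a = solve 1 (λ a → (:- con 1ℚ) :* a := :- a) refl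

  [a*s]*s≡a*[s*s] : ∀ a s → (a * s) * s ≡ a * (s * s)
  [a*s]*s≡a*[s*s] = solve 2 (λ a s → (a :* s) :* s := a :* (s :* s)) refl

vec-orient : ∀ {r} (α : Root r) p → vec (orient α) p ≡ rootOrientation α * vec α p
vec-orient ((i , j) , _) p with toℕ i ℕ.<? toℕ j
... | yes _ = sym (ℚP.*-identityˡ _)
... | no _  = b-a≡-1*[a-b] (δ i p) (δ j p)

evalRoot-orient : ∀ {r} (x : Point r) (α : Root r) → evalRoot x (orient α) ≡ rootOrientation α * evalRoot x α
evalRoot-orient x ((i , j) , _) with toℕ i ℕ.<? toℕ j
... | yes _ = sym (ℚP.*-identityˡ _)
... | no _  = b-a≡-1*[a-b] (ext x i) (ext x j)

inv-neg : ∀ q → inv (- q) ≡ - inv q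
inv-neg (ℚ.mkℚ (ℤ.+ zero) d c) with ℚ.mkℚ (ℤ.+ zero) d c ℚP.≟ 0ℚ
... | yes _    = refl
... | no q≢0   = ⊥-elim (ℕ.NonZero.nonZero (ℚ.≢-nonZero q≢0))
inv-neg (ℚ.mkℚ (ℤ.+ suc n) d c) = refl
inv-neg (ℚ.mkℚ -[1+ n ] d c)    = refl

inv-orientation : ∀ {r} (α : Root r) q → inv (rootOrientation α * q) ≡ rootOrientation α * inv q
inv-orientation ((i , j) , _) q with toℕ i ℕ.<? toℕ j
... | yes _ = trans (cong inv (ℚP.*-identityˡ q)) (sym (ℚP.*-identityˡ _))
... | no _  = trans (cong inv (-1*a≡-a q)) (trans (inv-neg q) (sym (-1*a≡-a _)))

comb-orient : ∀ {r} (σ : Fin r → Root r) t p →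
  comb (orient ∘ σ) t p ≡ comb σ (λ k → t k * rootOrientation (σ k)) p
comb-orient σ t p = ∑-cong (λ k → trans (cong (t k *_) (vec-orient (σ k) p)) (sym (ℚP.*-assoc (t k) _ _)))

orientBasis : ∀ {r} → Basis r → Basis r
orientBasis {r} (σ , independent , spanning) = orient ∘ σ , independent′ , spanning′
  where
  s : Fin r → ℚ
  s k = rootOrientation (σ k)
  unsign : ∀ a k → (a * s k) * s k ≡ a
  unsign a k = trans ([a*s]*s≡a*[s*s] a (s k)) (trans (cong (a *_) (rootOrientation² (σ k))) (ℚP.*-identityʳ a))
  independent′ : ∀ (t : Fin r → ℚ) → comb (orient ∘ σ) t ≐ (λ _ → 0ℚ) → ∀ k → t k ≡ 0ℚ
  independent′ t comb≡0 k = begin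
    t k               ≡⟨ unsign (t k) k ⟨
    (t k * s k) * s k ≡⟨ cong (_* s k) (independent (λ k → t k * s k) signed≡0 k) ⟩
    0ℚ * s k          ≡⟨ ℚP.*-zeroˡ (s k) ⟩
    0ℚ                ∎
    where
    open ≡-Reasoning
    signed≡0 : comb σ (λ k → t k * s k) ≐ (λ _ → 0ℚ)
    signed≡0 p = trans (sym (comb-orient σ t p)) (comb≡0 p)
  spanning′ : ∀ (v : Vect r) → InE v → ∃ λ (t : Fin r → ℚ) → comb (orient ∘ σ) t ≐ v
  spanning′ v v∈E = (λ k → t k * s k) , λ p →
    trans (comb-orient σ (λ k → t k * s k) p) (trans (∑-cong (λ k → cong (_* vec (σ k) p) (unsign (t k) k))) (comb≡v p))
    where
    t : Fin r → ℚ
    t = proj₁ (spanning v v∈E)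
    comb≡v : comb σ t ≐ v
    comb≡v = proj₂ (spanning v v∈E)

evalF-orientBasis : ∀ {r} (B : Basis r) x → evalF (orientBasis B) x ≡ basisOrientation (proj₁ B) * evalF B x
evalF-orientBasis (σ , _) x =
  trans (∏-cong (λ k → trans (cong inv (evalRoot-orient x (σ k))) (inv-orientation (σ k) _)))
        (∏-distrib-* (rootOrientation ∘ σ) (λ k → inv (evalRoot x (σ k))))

form-orientBasis : ∀ {r} (ℓ : Basis r → ℚ) → IsLinearFormOnS ℓ → (B : Basis r) →
  ℓ B ≡ basisOrientation (proj₁ B) * ℓ (orientBasis B)
form-orientBasis ℓ linear B = begin
  ℓ B                                 ≡⟨ ℚP.*-identityˡ (ℓ B) ⟨
  1ℚ * ℓ B                            ≡⟨ ℚP.+-identityʳ (1ℚ * ℓ B) ⟨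
  extend ℓ ((1ℚ , B) ∷ [])            ≡⟨ linear ((1ℚ , B) ∷ []) ((s , orientBasis B) ∷ []) same ⟩
  extend ℓ ((s , orientBasis B) ∷ []) ≡⟨ ℚP.+-identityʳ (s * ℓ (orientBasis B)) ⟩
  s * ℓ (orientBasis B)               ∎
  where
  open ≡-Reasoning
  s : ℚ
  s = basisOrientation (proj₁ B)
  same : ((1ℚ , B) ∷ []) ≈S ((s , orientBasis B) ∷ [])
  same x _ = cong (_+ 0ℚ) (begin
    1ℚ * evalF B x              ≡⟨ ℚP.*-identityˡ _ ⟩
    evalF B x                   ≡⟨ ℚP.*-identityˡ _ ⟨
    1ℚ * evalF B x              ≡⟨ cong (_* evalF B x) (basisOrientation² (proj₁ B)) ⟨
    (s * s) * evalF B x         ≡⟨ ℚP.*-assoc s s _ ⟩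
    s * (s * evalF B x)         ≡⟨ cong (s *_) (evalF-orientBasis B x) ⟨
    s * evalF (orientBasis B) x ∎)

-- The chamber c⁺ and the cones of positive bases

∑-zero : ∀ {n} (f : Fin n → ℚ) → (∀ k → f k ≡ 0ℚ) → ∑ f ≡ 0ℚ
∑-zero {zero}  f f≗0 = refl
∑-zero {suc n} f f≗0 = cong₂ _+_ (f≗0 Fin.zero) (∑-zero (f ∘ Fin.suc) (f≗0 ∘ Fin.suc))

∑-nonneg : ∀ {n} (f : Fin n → ℚ) → (∀ k → 0ℚ ℚ.≤ f k) → 0ℚ ℚ.≤ ∑ f
∑-nonneg {zero}  f f≥0 = ℚP.≤-refl
∑-nonneg {suc n} f f≥0 = ℚP.+-mono-≤ (f≥0 Fin.zero) (∑-nonneg (f ∘ Fin.suc) (f≥0 ∘ Fin.suc))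

∑-single : ∀ {n} (f : Fin n → ℚ) k → (∀ k′ → k′ ≢ k → f k′ ≡ 0ℚ) → ∑ f ≡ f k
∑-single {suc n} f Fin.zero    others =
  trans (cong (f Fin.zero +_) (∑-zero (f ∘ Fin.suc) (λ k → others (Fin.suc k) (λ ())))) (ℚP.+-identityʳ _)
∑-single {suc n} f (Fin.suc k) others =
  trans (cong (_+ ∑ (f ∘ Fin.suc)) (others Fin.zero (λ ())))
    (trans (ℚP.+-identityˡ _) (∑-single (f ∘ Fin.suc) k (λ k′ k′≢k → others (Fin.suc k′) (k′≢k ∘ FinP.suc-injective))))

module _ where
  open +-*-Solver

  [a-b]+[c-d] : ∀ a b c d → (a - b) + (c - d) ≡ (a + c) - (b + d)
  [a-b]+[c-d] = solve 4 (λ a b c d → (a :- b) :+ (c :- d) := (a :+ c) :- (b :+ d)) refl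

  t*[x-y] : ∀ t x y → t * (x - y) ≡ t * x - t * y
  t*[x-y] = solve 3 (λ t x y → t :* (x :- y) := t :* x :- t :* y) refl

  a≡[a-b]+b : ∀ a b → a ≡ (a - b) + b
  a≡[a-b]+b = solve 2 (λ a b → a := (a :- b) :+ b) refl

∑-sub : ∀ {n} (f g : Fin n → ℚ) → ∑ (λ k → f k - g k) ≡ ∑ f - ∑ g
∑-sub {zero}  f g = refl
∑-sub {suc n} f g = trans (cong (f Fin.zero - g Fin.zero +_) (∑-sub (f ∘ Fin.suc) (g ∘ Fin.suc)))
  ([a-b]+[c-d] (f Fin.zero) (g Fin.zero) _ _)

δ-same : ∀ {n} (i : Fin n) → δ i i ≡ 1ℚ
δ-same i with i Fin.≟ i
... | yes _  = refl
... | no i≢i = ⊥-elim (i≢i refl)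

δ-other : ∀ {n} (i p : Fin n) → p ≢ i → δ i p ≡ 0ℚ
δ-other i p p≢i with p Fin.≟ i
... | yes p≡i = ⊥-elim (p≢i p≡i)
... | no _    = refl

*δ-nonneg : ∀ {n} t (i p : Fin n) → (p ≡ i → 0ℚ ℚ.≤ t) → 0ℚ ℚ.≤ t * δ i p
*δ-nonneg t i p t≥0 with p Fin.≟ i
... | yes p≡i = subst (0ℚ ℚ.≤_) (sym (ℚP.*-identityʳ t)) (t≥0 p≡i)
... | no _    = ℚP.≤-reflexive (sym (ℚP.*-zeroʳ t))

sources : ∀ {r} → (Fin r → Root r) → (Fin r → ℚ) → Fin (suc r) → ℚ
sources τ t P = ∑ (λ k → t k * δ (source (τ k)) P)

targets : ∀ {r} → (Fin r → Root r) → (Fin r → ℚ) → Fin (suc r) → ℚ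
targets τ t P = ∑ (λ k → t k * δ (target (τ k)) P)

comb≡sources-targets : ∀ {r} (τ : Fin r → Root r) t P → comb τ t P ≡ sources τ t P - targets τ t P
comb≡sources-targets τ t P =
  trans (∑-cong (λ k → t*[x-y] (t k) _ _)) (∑-sub (λ k → t k * δ (source (τ k)) P) (λ k → t k * δ (target (τ k)) P))

-- At a coordinate w that is no lower index, every root of the oriented basis has entry 0 or −1,
-- so the cone lies in {v_w ≤ 0}.
orientBasis-disjoint : ∀ {r} (B : Basis r) (w : Fin r) → (∀ k → lowerIndex (proj₁ B k) ≢ toℕ w) →
  CplusDisjCone (orientBasis B)
orientBasis-disjoint {r} (σ , _) w missed v (_ , positive) (t , t≥0 , comb≡v) =
  ℚP.<-irrefl refl (ℚP.<-≤-trans 0<vP vP≤0)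
  where
  P : Fin (suc r)
  P = Fin.inject₁ w
  0<vP : 0ℚ ℚ.< v P
  0<vP = positive P (subst (ℕ._< r) (sym (FinP.toℕ-inject₁ w)) (FinP.toℕ<n w))
  noSource : ∀ k → P ≢ source (orient (σ k))
  noSource k P≡s = missed k (trans (cong toℕ (sym P≡s)) (FinP.toℕ-inject₁ w))
  vP≤0 : v P ℚ.≤ 0ℚ
  vP≤0 = begin
    v P                                          ≡⟨ comb≡v P ⟨
    comb (orient ∘ σ) t P                        ≡⟨ comb≡sources-targets (orient ∘ σ) t P ⟩
    sources (orient ∘ σ) t P - targets (orient ∘ σ) t P
      ≡⟨ cong (_- targets (orient ∘ σ) t P)
           (∑-zero _ (λ k → trans (cong (t k *_) (δ-other _ P (noSource k))) (ℚP.*-zeroʳ (t k)))) ⟩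
    0ℚ - targets (orient ∘ σ) t P                ≡⟨ ℚP.+-identityˡ _ ⟩
    - targets (orient ∘ σ) t P                   ≤⟨ ℚP.neg-antimono-≤ targets≥0 ⟩
    - 0ℚ                                         ∎
    where
    open ℚP.≤-Reasoning
    targets≥0 : 0ℚ ℚ.≤ targets (orient ∘ σ) t P
    targets≥0 = ∑-nonneg _ (λ k → *δ-nonneg (t k) _ P (λ _ → t≥0 k))

-- With distinct lower indices, the coordinates of v ∈ c⁺ are solved triangularly:
-- t_k = v_{lower index of k} + (coefficients of roots with smaller lower index).
orientBasis-contains : ∀ {r} (B : Basis r) → (∀ k k′ → lowerIndex (proj₁ B k) ≡ lowerIndex (proj₁ B k′) → k ≡ k′) →
  CplusSubCone (orientBasis B)
orientBasis-contains {r} B@(σ , _) injective v (v∈E , positive) =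
  t , (λ k → <-rec Nonneg nonneg (lowerIndex (σ k)) k refl) , comb≡v
  where
  τ : Fin r → Root r
  τ = orient ∘ σ
  t : Fin r → ℚ
  t = proj₁ (proj₂ (proj₂ (orientBasis B)) v v∈E)
  comb≡v : comb τ t ≐ v
  comb≡v = proj₂ (proj₂ (proj₂ (orientBasis B)) v v∈E)
  Nonneg : ℕ → Set
  Nonneg m = ∀ k → lowerIndex (σ k) ≡ m → 0ℚ ℚ.≤ t k
  nonneg : ∀ m → (∀ {m′} → m′ ℕ.< m → Nonneg m′) → Nonneg m
  nonneg m below k refl = subst (0ℚ ℚ.≤_) (sym tk≡vP+targets) (ℚP.+-mono-≤ (ℚP.<⇒≤ 0<vP) targets≥0)
    where
    P : Fin (suc r)
    P = source (τ k)
    0<vP : 0ℚ ℚ.< v P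
    0<vP = positive P (lowerIndex<r (σ k))
    sources≡tk : sources τ t P ≡ t k
    sources≡tk = trans
      (∑-single _ k (λ k′ k′≢k → trans (cong (t k′ *_)
        (δ-other _ P (λ P≡s → k′≢k (injective k′ k (cong toℕ (sym P≡s)))))) (ℚP.*-zeroʳ (t k′))))
      (trans (cong (t k *_) (δ-same P)) (ℚP.*-identityʳ (t k)))
    targets≥0 : 0ℚ ℚ.≤ targets τ t P
    targets≥0 = ∑-nonneg _ (λ k′ → *δ-nonneg (t k′) _ P (λ P≡t →
      below (subst (lowerIndex (σ k′) ℕ.<_) (cong toℕ (sym P≡t)) (orient-positive (σ k′))) k′ refl))
    tk≡vP+targets : t k ≡ v P + targets τ t P
    tk≡vP+targets = trans (a≡[a-b]+b (t k) (targets τ t P))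
      (cong (_+ targets τ t P) (trans (cong (_- targets τ t P) (sym sources≡tk))
        (trans (sym (comb≡sources-targets τ t P)) (comb≡v P))))

-- A second preimage of f k would leave a point outside the image of the section of f,
-- which then injects Fin (suc n) into Fin n.
surjective⇒injective : ∀ {n} (f : Fin n → Fin n) → (∀ p → ∃ λ k → f k ≡ p) → ∀ k k′ → f k ≡ f k′ → k ≡ k′
surjective⇒injective {suc n} f surjective k k′ fk≡fk′ with k Fin.≟ k′
... | yes k≡k′ = k≡k′
... | no k≢k′  = ⊥-elim (ℕP.<-irrefl refl (FinP.injective⇒≤ punchedSection-injective))
  where
  section : Fin (suc n) → Fin (suc n)
  section p = proj₁ (surjective p)
  f∘section : ∀ p → f (section p) ≡ p
  f∘section p = proj₂ (surjective p)
  section-injective : ∀ {p q} → section p ≡ section q → p ≡ q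
  section-injective {p} {q} eq = trans (sym (f∘section p)) (trans (cong f eq) (f∘section q))
  other : ∃ λ k″ → f k″ ≡ f k × section (f k) ≢ k″
  other with section (f k) Fin.≟ k
  ... | yes s≡k = k′ , sym fk≡fk′ , λ s≡k′ → k≢k′ (trans (sym s≡k) s≡k′)
  ... | no s≢k  = k , refl , s≢k
  missed : ∀ q → proj₁ other ≢ section q
  missed q k″≡s = proj₂ (proj₂ other) (trans (cong section q≡fk) (sym k″≡s))
    where
    q≡fk : f k ≡ q
    q≡fk = trans (sym (proj₁ (proj₂ other))) (trans (cong f k″≡s) (f∘section q))
  punchedSection-injective : ∀ {p q} → Fin.punchOut (missed p) ≡ Fin.punchOut (missed q) → p ≡ q
  punchedSection-injective eq = section-injective (FinP.punchOut-injective (missed _) (missed _) eq)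

lowerIndex-surjective⇒injective : ∀ {r} (σ : Fin r → Root r) → (∀ (p : Fin r) → ∃ λ k → lowerIndex (σ k) ≡ toℕ p) →
  ∀ k k′ → lowerIndex (σ k) ≡ lowerIndex (σ k′) → k ≡ k′
lowerIndex-surjective⇒injective σ surjective k k′ eq =
  surjective⇒injective lowerVar (λ p → let (k , hit) = surjective p in k , FinP.toℕ-injective (trans (toℕ-lowerVar k) hit))
    k k′ (FinP.toℕ-injective (trans (toℕ-lowerVar k) (trans eq (sym (toℕ-lowerVar k′)))))
  where
  lowerVar : Fin _ → Fin _
  lowerVar k = Fin.fromℕ< (lowerIndex<r (σ k))
  toℕ-lowerVar : ∀ k → toℕ (lowerVar k) ≡ lowerIndex (σ k)
  toℕ-lowerVar k = FinP.toℕ-fromℕ< (lowerIndex<r (σ k))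

form≡Ires-generator : ∀ {r} (ℓ : Basis r → ℚ) → IsCplusForm ℓ → ∀ c B →
  c * ℓ B ≡ constValue (IresF (generatorTerm c B ∷ []))
form≡Ires-generator ℓ (linear , chamber) c B@(σ , b)
  with FinP.all? (λ p → FinP.any? (λ k → lowerIndex (σ k) ℕ.≟ toℕ p))
... | yes surjective = begin
  c * ℓ B                                    ≡⟨ cong (c *_) (form-orientBasis ℓ linear B) ⟩
  c * (basisOrientation σ * ℓ (orientBasis B)) ≡⟨ cong (λ x → c * (basisOrientation σ * x)) ℓ⁺≡1 ⟩
  c * (basisOrientation σ * 1ℚ)              ≡⟨ cong (c *_) (ℚP.*-identityʳ (basisOrientation σ)) ⟩
  c * basisOrientation σ                     ≡⟨ Ires-generator-bijective c σ b injective surjective ⟨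
  constValue (IresF (generatorTerm c B ∷ [])) ∎
  where
  open ≡-Reasoning
  injective : ∀ k k′ → lowerIndex (σ k) ≡ lowerIndex (σ k′) → k ≡ k′
  injective = lowerIndex-surjective⇒injective σ surjective
  ℓ⁺≡1 : ℓ (orientBasis B) ≡ 1ℚ
  ℓ⁺≡1 = proj₁ (chamber (orientBasis B) (orient-positive ∘ σ)) (orientBasis-contains B injective)
... | no ¬surjective = begin
  c * ℓ B                                    ≡⟨ cong (c *_) (form-orientBasis ℓ linear B) ⟩
  c * (basisOrientation σ * ℓ (orientBasis B)) ≡⟨ cong (λ x → c * (basisOrientation σ * x)) ℓ⁺≡0 ⟩
  c * (basisOrientation σ * 0ℚ)              ≡⟨ cong (c *_) (ℚP.*-zeroʳ (basisOrientation σ)) ⟩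
  c * 0ℚ                                     ≡⟨ ℚP.*-zeroʳ c ⟩
  0ℚ                                         ≡⟨ cong constValue (Ires-generator-missing c σ b w missed) ⟨
  constValue (IresF (generatorTerm c B ∷ [])) ∎
  where
  open ≡-Reasoning
  missing : ∃ λ w → ¬ (∃ λ k → lowerIndex (σ k) ≡ toℕ w)
  missing = FinP.¬∀⟶∃¬ _ _ (λ p → FinP.any? (λ k → lowerIndex (σ k) ℕ.≟ toℕ p)) ¬surjective
  w : Fin _
  w = proj₁ missing
  missed : ∀ k → lowerIndex (σ k) ≢ toℕ w
  missed k hit = proj₂ missing (k , hit)
  ℓ⁺≡0 : ℓ (orientBasis B) ≡ 0ℚ
  ℓ⁺≡0 = proj₂ (chamber (orientBasis B) (orient-positive ∘ σ)) (orientBasis-disjoint B w missed)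

theorem19 : (r : ℕ) → 1 ≤ r → (ℓ : Basis r → ℚ) → IsCplusForm ℓ →
    (f : SElt r) → extend ℓ f ≡ Ires f
theorem19 r _    ℓ form []            = sym (cong constValue (residues-[] (allFin r)))
theorem19 r r≥1  ℓ form ((c , B) ∷ f) = begin
  c * ℓ B + extend ℓ f
    ≡⟨ cong₂ _+_ (form≡Ires-generator ℓ form c B) (theorem19 r r≥1 ℓ form f) ⟩
  constValue (IresF (generatorTerm c B ∷ [])) + constValue (IresF (toFunc f))
    ≡⟨ constValue-++ (IresF (generatorTerm c B ∷ [])) (IresF (toFunc f)) ⟨
  constValue (IresF (generatorTerm c B ∷ []) ++ IresF (toFunc f))
    ≡⟨ cong constValue (residues-++ (allFin r) (generatorTerm c B ∷ []) (toFunc f)) ⟨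
  Ires ((c , B) ∷ f)
    ∎
  where open ≡-Reasoning
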